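{- For every positive integer $n$, a complete generalized Zeckendorf game on $n$ consisting only of combining moves has the smallest number of moves among all complete games on $n$.
   Context: Let $a_1=1$, $a_2=2$ and $a_{i+1}=i\,a_i+a_{i-1}$ for $i\ge 2$. The generalized Zeckendorf game on $n$: the state is a multiset of terms of the sequence, initially $n$ copies of $a_1=1$. A move is one of: (combining) replace two $1$'s by one $2$; or, for $i\ge 2$, if the multiset contains at least $i$ copies of $a_i$ and at least one $a_{i-1}$, replace $i$ copies of $a_i$ and one $a_{i-1}$ by one $a_{i+1}$; (splitting) if it contains three $2$'s, replace them by one $1$ and one $5$; or, for $i\ge 3$, if it contains $i+1$ copies of $a_i$, replace them by one $a_{i+1}$, $i-2$ copies of $a_{i-1}$ and one $a_{i-2}$. The game ends when no move is available. A complete game is a sequence of legal moves from the initial state to a state with no available move. -}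

module Defs where

open import Data.Nat using (ℕ; zero; suc; _+_; _*_; _∸_; _≤_; _≡ᵇ_)
open import Data.Bool using (if_then_else_)
open import Data.Empty using (⊥)
open import Data.Unit using (⊤)
open import Data.Product using (_×_)
open import Data.List using (List; []; _∷_)
open import Relation.Nullary using (¬_)

-- The sequence a_1 = 1, a_2 = 2, a_{i+1} = i a_i + a_{i-1} (i ≥ 2).
-- (a 0 is an unused dummy value.)
a : ℕ → ℕ
a 0 = 0
a 1 = 1
a 2 = 2
a (suc (suc (suc i))) = suc (suc i) * a (suc (suc i)) + a (suc i)

-- A game state is a multiset of terms of the sequence, recorded as the
-- function  i ↦ (number of copies of a_i)  for indices i ≥ 1
-- (the value at index 0 is irrelevant and always 0 in reachable states).
State : Set
State = ℕ → ℕ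

init : ℕ → State
init n 1 = n
init n _ = 0

add : ℕ → ℕ → State → State
add k c s j = if j ≡ᵇ k then s j + c else s j

sub : ℕ → ℕ → State → State
sub k c s j = if j ≡ᵇ k then s j ∸ c else s j

-- Moves:  comb i  is the combining move producing a_{i+1} (i ≥ 1),
--         split i is the splitting move acting on i+1 (resp. 3) copies of a_i (i ≥ 2).
data Move : Set where
  comb  : ℕ → Move
  split : ℕ → Move

IsComb : Move → Set
IsComb (comb _)  = ⊤
IsComb (split _) = ⊥

Legal : Move → State → Set
Legal (comb 0) s = ⊥
Legal (comb 1) s = 2 ≤ s 1
-- i copies of a_i and one a_{i-1}  →  one a_{i+1}   (i ≥ 2)
Legal (comb (suc (suc j))) s = suc (suc j) ≤ s (suc (suc j)) × 1 ≤ s (suc j)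
Legal (split 0) s = ⊥
Legal (split 1) s = ⊥
-- three 2's  →  one 1 and one 5
Legal (split 2) s = 3 ≤ s 2
-- i+1 copies of a_i  →  one a_{i+1}, i-2 copies of a_{i-1}, one a_{i-2}   (i ≥ 3)
Legal (split (suc (suc (suc j)))) s = suc (suc (suc (suc j))) ≤ s (suc (suc (suc j)))

-- Effect of a move (only meaningful when it is legal).
apply : Move → State → State
apply (comb 0) s = s
apply (comb 1) s = add 2 1 (sub 1 2 s)
apply (comb (suc (suc j))) s =
  add (suc (suc (suc j))) 1 (sub (suc j) 1 (sub (suc (suc j)) (suc (suc j)) s))
apply (split 0) s = s
apply (split 1) s = s
apply (split 2) s = add 3 1 (add 1 1 (sub 2 3 s))
apply (split (suc (suc (suc j)))) s =
  add (suc j) 1 (add (suc (suc j)) (suc j)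
    (add (suc (suc (suc (suc j)))) 1 (sub (suc (suc (suc j))) (suc (suc (suc (suc j)))) s)))

Terminal : State → Set
Terminal s = (m : Move) → ¬ Legal m s

data CompleteFrom : State → List Move → Set where
  done : ∀ {s} → Terminal s → CompleteFrom s []
  step : ∀ {s m ms} → Legal m s → CompleteFrom (apply m s) ms → CompleteFrom s (m ∷ ms)

CompleteGame : ℕ → List Move → Set
CompleteGame n ms = CompleteFrom (init n) ms

{-# OPTIONS --safe #-}
module Submission where

-- Weigh a state s by Σ_{j ≥ 1} s_j w_j. With the weights a every move preserves the weight, so
-- every complete game on n ends in a terminal state of a-weight n. A terminal state holds at most
-- i copies of a_i, and no a_{i-1} when it holds exactly i, so it is a greedy mixed-radix
-- representation of n and hence unique. The weights β obey the recurrence of a with an extra +1;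
-- under them each combining move raises the weight by one and each splitting move keeps it. Thus
-- all complete games on n have the same number of combining moves, and one consisting of
-- combining moves only is therefore no longer than any other.

open import Defs
open import Algebra.Properties.CommutativeSemigroup using (xy∙z≈xz∙y; x∙yz≈xz∙y)
open import Data.Bool using (true; false)
open import Data.Bool.Properties using (T-≡; ¬-not)
open import Data.List using (List; []; _∷_; length; filter; map)
open import Data.List.Properties using (length-filter; filter-all)
open import Data.List.Relation.Unary.All using (All)
open import Data.Nat using (ℕ; zero; suc; _+_; _*_; _∸_; _≤_; _<_; _≡ᵇ_; z≤n; s≤s; z<s)
open import Data.Nat.DivMod using (_%_; [m+kn]%n≡m%n; m<n⇒m%n≡m)
open import Data.Nat.ListAction using (sum)
open import Data.Nat.Properties
open import Data.Nat.Tactic.RingSolver using (solve)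
open import Data.Product using (_×_; _,_)
open import Data.Sum using (inj₁; inj₂)
open import Data.Unit using (⊤; tt)
open import Function.Base using (_∘_)
open import Function.Bundles using (Equivalence)
open import Relation.Binary.PropositionalEquality
open import Relation.Nullary using (yes; no; contradiction)
open import Relation.Unary using (Decidable)

private
  variable
    s t t′ : State
    ms ms′ : List Move

≡ᵇ-refl : ∀ k → (k ≡ᵇ k) ≡ true
≡ᵇ-refl k = Equivalence.to T-≡ (≡⇒≡ᵇ k k refl)

≢⇒≡ᵇ-false : ∀ {j k} → j ≢ k → (j ≡ᵇ k) ≡ false
≢⇒≡ᵇ-false {j} {k} j≢k = ¬-not (λ eq → j≢k (≡ᵇ⇒≡ j k (Equivalence.from T-≡ eq)))

add-≡ : ∀ k c s → add k c s k ≡ s k + c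
add-≡ k c s rewrite ≡ᵇ-refl k = refl

add-≢ : ∀ {j k} c s → j ≢ k → add k c s j ≡ s j
add-≢ c s j≢k rewrite ≢⇒≡ᵇ-false j≢k = refl

sub-≡ : ∀ k c s → sub k c s k ≡ s k ∸ c
sub-≡ k c s rewrite ≡ᵇ-refl k = refl

sub-≢ : ∀ {j k} c s → j ≢ k → sub k c s j ≡ s j
sub-≢ c s j≢k rewrite ≢⇒≡ᵇ-false j≢k = refl

weigh : (ℕ → ℕ) → ℕ → State → ℕ
weigh w zero s = 0
weigh w (suc K) s = weigh w K s + s (suc K) * w (suc K)

weigh-cong : ∀ w K {f g : State} → (∀ j → j ≤ K → f j ≡ g j) → weigh w K f ≡ weigh w K g
weigh-cong w zero f≗g = refl
weigh-cong w (suc K) f≗g = cong₂ _+_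
  (weigh-cong w K (λ j j≤K → f≗g j (m≤n⇒m≤1+n j≤K))) (cong (_* w (suc K)) (f≗g (suc K) ≤-refl))

weigh-bump : ∀ w K {k} c (f g : State) → 1 ≤ k → k ≤ K →
  g k ≡ f k + c → (∀ j → j ≢ k → g j ≡ f j) → weigh w K g ≡ weigh w K f + c * w k
weigh-bump w zero c f g (s≤s _) ()
weigh-bump w (suc K) {k} c f g 1≤k k≤1+K gk elsewhere with suc K ≟ k
... | yes refl = begin
  weigh w K g + g (suc K) * w (suc K)
    ≡⟨ cong₂ (λ x y → x + y * w (suc K)) below gk ⟩
  weigh w K f + (f (suc K) + c) * w (suc K)
    ≡⟨ cong (weigh w K f +_) (*-distribʳ-+ (w (suc K)) (f (suc K)) c) ⟩
  weigh w K f + (f (suc K) * w (suc K) + c * w (suc K))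
    ≡⟨ +-assoc (weigh w K f) _ _ ⟨
  weigh w K f + f (suc K) * w (suc K) + c * w (suc K) ∎
  where
  open ≡-Reasoning
  below : weigh w K g ≡ weigh w K f
  below = weigh-cong w K (λ j j≤K → elsewhere j (<⇒≢ (s≤s j≤K)))
... | no 1+K≢k = begin
  weigh w K g + g (suc K) * w (suc K)
    ≡⟨ cong₂ (λ x y → x + y * w (suc K)) below (elsewhere (suc K) 1+K≢k) ⟩
  weigh w K f + c * w k + f (suc K) * w (suc K)
    ≡⟨ xy∙z≈xz∙y +-commutativeSemigroup (weigh w K f) _ _ ⟩
  weigh w K f + f (suc K) * w (suc K) + c * w k ∎
  where
  open ≡-Reasoning
  below : weigh w K g ≡ weigh w K f + c * w k
  below = weigh-bump w K c f g 1≤k (≤-pred (≤∧≢⇒< k≤1+K (1+K≢k ∘ sym))) gk elsewhere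

weigh-add : ∀ w K {k} c s → 1 ≤ k → k ≤ K → weigh w K (add k c s) ≡ weigh w K s + c * w k
weigh-add w K {k} c s 1≤k k≤K = weigh-bump w K c s (add k c s) 1≤k k≤K (add-≡ k c s) (λ j → add-≢ c s)

weigh-sub : ∀ w K {k} c s → 1 ≤ k → k ≤ K → c ≤ s k → weigh w K s ≡ weigh w K (sub k c s) + c * w k
weigh-sub w K {k} c s 1≤k k≤K c≤sk = weigh-bump w K c (sub k c s) s 1≤k k≤K
  (trans (sym (m∸n+n≡m c≤sk)) (cong (_+ c) (sym (sub-≡ k c s)))) (λ j j≢k → sym (sub-≢ c s j≢k))

-- A bag lists (index i, number of copies of a_i).
Bag : Set
Bag = List (ℕ × ℕ)

mass : (ℕ → ℕ) → Bag → ℕ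
mass w [] = 0
mass w ((k , c) ∷ b) = c * w k + mass w b

addBag : Bag → State → State
addBag [] s = s
addBag ((k , c) ∷ b) s = addBag b (add k c s)

removeBag : Bag → State → State
removeBag [] s = s
removeBag ((k , c) ∷ b) s = removeBag b (sub k c s)

Available : Bag → State → Set
Available [] s = ⊤
Available ((k , c) ∷ b) s = c ≤ s k × Available b (sub k c s)

InRange : ℕ → Bag → Set
InRange K [] = ⊤
InRange K ((k , _) ∷ b) = (1 ≤ k × k ≤ K) × InRange K b

weigh-addBag : ∀ w K b s → InRange K b → weigh w K (addBag b s) ≡ weigh w K s + mass w b
weigh-addBag w K [] s tt = sym (+-identityʳ _)
weigh-addBag w K ((k , c) ∷ b) s ((1≤k , k≤K) , inRange) = begin
  weigh w K (addBag b (add k c s))    ≡⟨ weigh-addBag w K b (add k c s) inRange ⟩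
  weigh w K (add k c s) + mass w b    ≡⟨ cong (_+ mass w b) (weigh-add w K c s 1≤k k≤K) ⟩
  weigh w K s + c * w k + mass w b    ≡⟨ +-assoc (weigh w K s) _ _ ⟩
  weigh w K s + (c * w k + mass w b)  ∎
  where open ≡-Reasoning

weigh-removeBag : ∀ w K b s → InRange K b → Available b s →
  weigh w K (removeBag b s) + mass w b ≡ weigh w K s
weigh-removeBag w K [] s tt tt = +-identityʳ _
weigh-removeBag w K ((k , c) ∷ b) s ((1≤k , k≤K) , inRange) (c≤sk , available) = begin
  weigh w K (removeBag b (sub k c s)) + (c * w k + mass w b)
    ≡⟨ x∙yz≈xz∙y +-commutativeSemigroup (weigh w K (removeBag b (sub k c s))) _ _ ⟩
  weigh w K (removeBag b (sub k c s)) + mass w b + c * w k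
    ≡⟨ cong (_+ c * w k) (weigh-removeBag w K b (sub k c s) inRange available) ⟩
  weigh w K (sub k c s) + c * w k
    ≡⟨ weigh-sub w K c s 1≤k k≤K c≤sk ⟨
  weigh w K s ∎
  where open ≡-Reasoning

consumed : Move → Bag
consumed (comb 0) = []
consumed (comb 1) = (1 , 2) ∷ []
consumed (comb (suc (suc j))) = (suc (suc j) , suc (suc j)) ∷ (suc j , 1) ∷ []
consumed (split 0) = []
consumed (split 1) = []
consumed (split 2) = (2 , 3) ∷ []
consumed (split (suc (suc (suc j)))) = (suc (suc (suc j)) , suc (suc (suc (suc j)))) ∷ []

produced : Move → Bag
produced (comb 0) = []
produced (comb 1) = (2 , 1) ∷ []
produced (comb (suc (suc j))) = (suc (suc (suc j)) , 1) ∷ []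
produced (split 0) = []
produced (split 1) = []
produced (split 2) = (1 , 1) ∷ (3 , 1) ∷ []
produced (split (suc (suc (suc j)))) =
  (suc (suc (suc (suc j))) , 1) ∷ (suc (suc j) , suc j) ∷ (suc j , 1) ∷ []

apply-via-bags : ∀ m s → apply m s ≡ addBag (produced m) (removeBag (consumed m) s)
apply-via-bags (comb 0) s = refl
apply-via-bags (comb 1) s = refl
apply-via-bags (comb (suc (suc j))) s = refl
apply-via-bags (split 0) s = refl
apply-via-bags (split 1) s = refl
apply-via-bags (split 2) s = refl
apply-via-bags (split (suc (suc (suc j)))) s = refl

legal⇒available : ∀ m → Legal m s → Available (consumed m) s
legal⇒available (comb 1) two≤ = two≤ , tt
legal⇒available {s} (comb (suc (suc j))) (full , nonempty) =
  full , subst (1 ≤_) (sym (sub-≢ (suc (suc j)) s (<⇒≢ ≤-refl))) nonempty , tt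
legal⇒available (split 2) three≤ = three≤ , tt
legal⇒available (split (suc (suc (suc j)))) full = full , tt

topIndex : Move → ℕ
topIndex (comb i) = suc i
topIndex (split i) = suc i

consumed-inRange : ∀ m {K} → topIndex m ≤ K → InRange K (consumed m)
consumed-inRange (comb 0) _ = tt
consumed-inRange (comb 1) 2≤K = (s≤s z≤n , m+n≤o⇒n≤o 1 2≤K) , tt
consumed-inRange (comb (suc (suc j))) top≤K =
  (s≤s z≤n , m+n≤o⇒n≤o 1 top≤K) , (s≤s z≤n , m+n≤o⇒n≤o 2 top≤K) , tt
consumed-inRange (split 0) _ = tt
consumed-inRange (split 1) _ = tt
consumed-inRange (split 2) 3≤K = (s≤s z≤n , m+n≤o⇒n≤o 1 3≤K) , tt
consumed-inRange (split (suc (suc (suc j)))) top≤K = (s≤s z≤n , m+n≤o⇒n≤o 1 top≤K) , tt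

produced-inRange : ∀ m {K} → topIndex m ≤ K → InRange K (produced m)
produced-inRange (comb 0) _ = tt
produced-inRange (comb 1) 2≤K = (s≤s z≤n , 2≤K) , tt
produced-inRange (comb (suc (suc j))) top≤K = (s≤s z≤n , top≤K) , tt
produced-inRange (split 0) _ = tt
produced-inRange (split 1) _ = tt
produced-inRange (split 2) 3≤K = (s≤s z≤n , m+n≤o⇒n≤o 2 3≤K) , (s≤s z≤n , 3≤K) , tt
produced-inRange (split (suc (suc (suc j)))) top≤K =
  (s≤s z≤n , top≤K) , (s≤s z≤n , m+n≤o⇒n≤o 2 top≤K) , (s≤s z≤n , m+n≤o⇒n≤o 3 top≤K) , tt

record Recurrence (w : ℕ → ℕ) (e : ℕ) : Set where
  field
    at-2   : w 2 ≡ 2 * w 1 + e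
    at-suc : ∀ i → w (suc (suc (suc i))) ≡ suc (suc i) * w (suc (suc i)) + w (suc i) + e

open Recurrence

gain : ℕ → Move → ℕ
gain e (comb _)  = e
gain e (split _) = 0

-- The recurrence is taken as an equation between variables, so that matching on refl leaves a
-- pure semiring identity for the solver.
comb₁-balance : ∀ x y e → y ≡ 2 * x + e → 1 * y + 0 ≡ 2 * x + 0 + e
comb₁-balance x _ e refl = solve (x ∷ e ∷ [])

comb-balance : ∀ j x y z e → z ≡ suc (suc j) * y + x + e →
  1 * z + 0 ≡ suc (suc j) * y + (1 * x + 0) + e
comb-balance j x y _ e refl = solve (x ∷ y ∷ e ∷ j ∷ [])

split₂-balance : ∀ x y z e → y ≡ 2 * x + e → z ≡ 2 * y + x + e →
  1 * x + (1 * z + 0) ≡ 3 * y + 0 + 0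
split₂-balance x _ _ e refl refl = solve (x ∷ e ∷ [])

split-balance : ∀ j x y z u e → z ≡ suc (suc j) * y + x + e → u ≡ suc (suc (suc j)) * z + y + e →
  1 * u + (suc j * y + (1 * x + 0)) ≡ suc (suc (suc (suc j))) * z + 0 + 0
split-balance j x y _ _ e refl refl = solve (x ∷ y ∷ e ∷ j ∷ [])

-- Legality only serves to exclude the degenerate moves comb 0, split 0 and split 1.
mass-balance : ∀ {w e} → Recurrence w e → ∀ m → Legal m s →
  mass w (produced m) ≡ mass w (consumed m) + gain e m
mass-balance {w = w} {e} rec (comb 1) _ = comb₁-balance (w 1) (w 2) e (at-2 rec)
mass-balance {w = w} {e} rec (comb (suc (suc j))) _ =
  comb-balance j (w (suc j)) (w (suc (suc j))) _ e (at-suc rec j)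
mass-balance {w = w} {e} rec (split 2) _ =
  split₂-balance (w 1) (w 2) (w 3) e (at-2 rec) (at-suc rec 0)
mass-balance {w = w} {e} rec (split (suc (suc (suc j)))) _ =
  split-balance j (w (suc j)) (w (suc (suc j))) (w (suc (suc (suc j)))) _ e
    (at-suc rec j) (at-suc rec (suc j))

weigh-apply : ∀ {w e} → Recurrence w e → ∀ K m s → Legal m s → topIndex m ≤ K →
  weigh w K (apply m s) ≡ weigh w K s + gain e m
weigh-apply {w} {e} rec K m s legal top≤K = begin
  weigh w K (apply m s)                          ≡⟨ cong (weigh w K) (apply-via-bags m s) ⟩
  weigh w K (addBag (produced m) r)              ≡⟨ weigh-addBag w K (produced m) r (produced-inRange m top≤K) ⟩
  weigh w K r + mass w (produced m)              ≡⟨ cong (weigh w K r +_) (mass-balance rec m legal) ⟩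
  weigh w K r + (mass w (consumed m) + gain e m) ≡⟨ +-assoc (weigh w K r) _ _ ⟨
  weigh w K r + mass w (consumed m) + gain e m   ≡⟨ cong (_+ gain e m) removed ⟩
  weigh w K s + gain e m                         ∎
  where
  open ≡-Reasoning
  r : State
  r = removeBag (consumed m) s
  removed : weigh w K r + mass w (consumed m) ≡ weigh w K s
  removed = weigh-removeBag w K (consumed m) s (consumed-inRange m top≤K) (legal⇒available m legal)

isComb? : Decidable IsComb
isComb? (comb _)  = yes tt
isComb? (split _) = no (λ ())

combCount : List Move → ℕ
combCount ms = length (filter isComb? ms)

indexSum : List Move → ℕ
indexSum ms = sum (map topIndex ms)

final : CompleteFrom s ms → State
final {s} (done _) = s
final (step _ game) = final game

final-terminal : (game : CompleteFrom s ms) → Terminal (final game)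
final-terminal (done terminal) = terminal
final-terminal (step _ game) = final-terminal game

gain+combCount : ∀ e m ms → gain e m + e * combCount ms ≡ e * combCount (m ∷ ms)
gain+combCount e (comb _) ms = sym (*-suc e (combCount ms))
gain+combCount e (split _) ms = refl

weigh-final : ∀ {w e} → Recurrence w e → ∀ K (game : CompleteFrom s ms) → indexSum ms ≤ K →
  weigh w K (final game) ≡ weigh w K s + e * combCount ms
weigh-final {s = s} {w = w} {e} rec K (done _) _ = begin
  weigh w K s                        ≡⟨ +-identityʳ (weigh w K s) ⟨
  weigh w K s + 0                    ≡⟨ cong (weigh w K s +_) (*-zeroʳ e) ⟨
  weigh w K s + e * combCount []     ∎
  where open ≡-Reasoning
weigh-final {s = s} {w = w} {e} rec K (step {m = m} {ms} legal game) bound = begin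
  weigh w K (final game)                         ≡⟨ weigh-final rec K game (m+n≤o⇒n≤o (topIndex m) bound) ⟩
  weigh w K (apply m s) + e * combCount ms       ≡⟨ cong (_+ e * combCount ms) moved ⟩
  weigh w K s + gain e m + e * combCount ms      ≡⟨ +-assoc (weigh w K s) _ _ ⟩
  weigh w K s + (gain e m + e * combCount ms)    ≡⟨ cong (weigh w K s +_) (gain+combCount e m ms) ⟩
  weigh w K s + e * combCount (m ∷ ms)           ∎
  where
  open ≡-Reasoning
  moved : weigh w K (apply m s) ≡ weigh w K s + gain e m
  moved = weigh-apply rec K m s legal (m+n≤o⇒m≤o (topIndex m) bound)

terminal-a₁ : Terminal t → t 1 ≤ 1
terminal-a₁ terminal = ≤-pred (≰⇒> (terminal (comb 1)))

terminal-≤ : Terminal t → ∀ j → t (suc (suc j)) ≤ suc (suc j)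
terminal-≤ terminal zero    = ≤-pred (≰⇒> (terminal (split 2)))
terminal-≤ terminal (suc j) = ≤-pred (≰⇒> (terminal (split (suc (suc (suc j))))))

terminal-full⇒empty-below : Terminal t → ∀ j → t (suc (suc j)) ≡ suc (suc j) → t (suc j) ≡ 0
terminal-full⇒empty-below {t} terminal j full with t (suc j) in below
... | zero  = refl
... | suc _ =
  contradiction (≤-reflexive (sym full) , subst (1 ≤_) (sym below) (s≤s z≤n)) (terminal (comb (suc (suc j))))

terminal-weigh-<-step : Terminal t → ∀ j →
  weigh a j t < a (suc j) → weigh a (suc j) t < a (suc (suc j)) → weigh a (suc (suc j)) t < a (suc (suc (suc j)))
terminal-weigh-<-step {t} terminal j below₀ below₁ with m≤n⇒m<n∨m≡n (terminal-≤ terminal j)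
... | inj₂ full = begin-strict
  weigh a j t + t (suc j) * a (suc j) + t (suc (suc j)) * a (suc (suc j))
    ≡⟨ cong₂ (λ x y → weigh a j t + x * a (suc j) + y * a (suc (suc j)))
             (terminal-full⇒empty-below terminal j full) full ⟩
  weigh a j t + 0 + suc (suc j) * a (suc (suc j))
    ≡⟨ cong (_+ suc (suc j) * a (suc (suc j))) (+-identityʳ (weigh a j t)) ⟩
  weigh a j t + suc (suc j) * a (suc (suc j))
    <⟨ +-monoˡ-< _ below₀ ⟩
  a (suc j) + suc (suc j) * a (suc (suc j))
    ≡⟨ +-comm (a (suc j)) _ ⟩
  a (suc (suc (suc j))) ∎
  where open ≤-Reasoning
... | inj₁ not-full = begin-strict
  weigh a (suc j) t + t (suc (suc j)) * a (suc (suc j))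
    <⟨ +-monoˡ-< _ below₁ ⟩
  a (suc (suc j)) + t (suc (suc j)) * a (suc (suc j))
    ≤⟨ +-monoʳ-≤ (a (suc (suc j))) (*-monoˡ-≤ (a (suc (suc j))) (≤-pred not-full)) ⟩
  suc (suc j) * a (suc (suc j))
    ≤⟨ m≤m+n _ (a (suc j)) ⟩
  a (suc (suc (suc j))) ∎
  where open ≤-Reasoning

terminal-weigh-< : Terminal t → ∀ k → weigh a k t < a (suc k)
terminal-weigh-< terminal zero = z<s
terminal-weigh-< {t} terminal (suc zero) rewrite *-identityʳ (t 1) = s≤s (terminal-a₁ terminal)
terminal-weigh-< terminal (suc (suc j)) =
  terminal-weigh-<-step terminal j (terminal-weigh-< terminal j) (terminal-weigh-< terminal (suc j))

remainder-quotient-unique : ∀ {d r r′ q q′} → r < d → r′ < d →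
  r + q * d ≡ r′ + q′ * d → r ≡ r′ × q ≡ q′
remainder-quotient-unique {suc d} {r} {r′} {q} {q′} r<d r′<d eq = same-remainder , same-quotient
  where
  open ≡-Reasoning
  same-remainder : r ≡ r′
  same-remainder = begin
    r                          ≡⟨ m<n⇒m%n≡m r<d ⟨
    r % suc d                  ≡⟨ [m+kn]%n≡m%n r q (suc d) ⟨
    (r + q * suc d) % suc d    ≡⟨ cong (_% suc d) eq ⟩
    (r′ + q′ * suc d) % suc d  ≡⟨ [m+kn]%n≡m%n r′ q′ (suc d) ⟩
    r′ % suc d                 ≡⟨ m<n⇒m%n≡m r′<d ⟩
    r′                         ∎
  same-quotient : q ≡ q′
  same-quotient = *-cancelʳ-≡ q q′ (suc d)
    (+-cancelˡ-≡ r′ _ _ (subst (λ x → x + q * suc d ≡ _) same-remainder eq))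

terminal-weigh-unique : ∀ w K → Terminal t → Terminal t′ →
  weigh a K t ≡ weigh a K t′ → weigh w K t ≡ weigh w K t′
terminal-weigh-unique w zero _ _ _ = refl
terminal-weigh-unique {t} {t′} w (suc K) terminal terminal′ eq
  with remainder-quotient-unique {q = t (suc K)} {q′ = t′ (suc K)}
         (terminal-weigh-< terminal K) (terminal-weigh-< terminal′ K) eq
... | lower , top =
  cong₂ (λ x y → x + y * w (suc K)) (terminal-weigh-unique w K terminal terminal′ lower) top

a-recurrence : Recurrence a 0
a-recurrence = record { at-2 = refl ; at-suc = λ i → sym (+-identityʳ _) }

-- β i is the number of combining moves that build one a_i out of ones.
β : ℕ → ℕ
β 0 = 0
β 1 = 0
β 2 = 1
β (suc (suc (suc i))) = suc (suc i) * β (suc (suc i)) + β (suc i) + 1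

β-recurrence : Recurrence β 1
β-recurrence = record { at-2 = refl ; at-suc = λ i → refl }

combCount-invariant : CompleteFrom s ms → CompleteFrom s ms′ → combCount ms ≡ combCount ms′
combCount-invariant {s} {ms} {ms′} game game′ =
  *-cancelˡ-≡ _ _ 1 (+-cancelˡ-≡ (weigh β K s) _ _ (begin
    weigh β K s + 1 * combCount ms   ≡⟨ weigh-final β-recurrence K game bound ⟨
    weigh β K (final game)           ≡⟨ same-β ⟩
    weigh β K (final game′)          ≡⟨ weigh-final β-recurrence K game′ bound′ ⟩
    weigh β K s + 1 * combCount ms′  ∎))
  where
  open ≡-Reasoning
  K : ℕ
  K = indexSum ms + indexSum ms′
  bound : indexSum ms ≤ K
  bound = m≤m+n _ _
  bound′ : indexSum ms′ ≤ K
  bound′ = m≤n+m _ _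
  same-a : weigh a K (final game) ≡ weigh a K (final game′)
  same-a = trans (weigh-final a-recurrence K game bound) (sym (weigh-final a-recurrence K game′ bound′))
  same-β : weigh β K (final game) ≡ weigh β K (final game′)
  same-β = terminal-weigh-unique β K (final-terminal game) (final-terminal game′) same-a

corollary6p6 : (n : ℕ) → 1 ≤ n → (ms ms′ : List Move) →
    CompleteGame n ms → All IsComb ms → CompleteGame n ms′ →
    length ms ≤ length ms′
corollary6p6 n _ ms ms′ game onlyComb game′ = begin
  length ms                     ≡⟨ cong length (filter-all isComb? onlyComb) ⟨
  length (filter isComb? ms)    ≡⟨ combCount-invariant game game′ ⟩
  length (filter isComb? ms′)   ≤⟨ length-filter isComb? ms′ ⟩
  length ms′                    ∎
  where open ≤-Reasoning
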